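{- Let $n\ge 1$. Let $Flip(2n)$ be the group generated by the in and out flip shuffles acting on a deck of $2n$ cards (where the state of the deck records both the order of the cards and the face-up/face-down orientation of each card), and let $Faro(4n)$ be the group of permutations of a deck of $4n$ cards generated by the in and out faro shuffles. Then $Flip(2n)$ and $Faro(4n)$ are isomorphic (as groups acting on decks); in particular $|Flip(2n)|=|Faro(4n)|$.
   Context: Positions in a deck of $m$ cards are labeled $0,1,\ldots,m-1$ from top to bottom. Faro shuffles on a deck of $2N$ cards: the out faro shuffle sends the card at position $i$ ($0\le i\le N-1$) to position $2i$ and the card at position $N+i$ to position $2i+1$; the in faro shuffle sends the card at position $i$ ($0\le i\le N-1$) to position $2i+1$ and the card at position $N+i$ to position $2i$. $Faro(2N)$ is the subgroup of the symmetric group on the $2N$ positions generated by these two permutations. Flip shuffles on a deck of $2n$ cards, each card being face-up or face-down: cut the deck into the top half (positions $0,\ldots,n-1$) and the bottom half (positions $n,\ldots,2n-1$), turn the bottom half over as a packet (this reverses its order and changes the face-up/face-down status of each of its cards), and perfectly interlace. For the out flip shuffle, for $0\le j\le n-1$ the new position $2j$ receives the card previously at position $j$ (orientation unchanged) and the new position $2j+1$ receives the card previously at position $2n-1-j$, turned over. For the in flip shuffle, the new position $2j$ receives the card previously at position $2n-1-j$, turned over, and the new position $2j+1$ receives the card previously at position $j$ (orientation unchanged). $Flip(2n)$ is the group generated by these two operations on the set of (ordering, orientation) configurations of the deck, i.e. a subgroup of the group of signed permutations of $2n$ objects. -}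

module Defs where

open import Data.Nat using (ℕ; zero; suc; _+_; _*_; _∸_; _<ᵇ_)
open import Data.Nat.DivMod using (_mod_)
open import Data.Fin using (Fin; toℕ)
open import Data.Bool using (Bool; if_then_else_; not)
open import Data.Product using (Σ; _×_; _,_; proj₁)
open import Data.List using (List; _∷_; [])
open import Data.List.Membership.Propositional using (_∈_)
open import Function using (_∘_; id)
open import Relation.Binary.PropositionalEquality using (_≡_)

-- A position p : Fin m is supplied as evidence that m ≠ 0; the value
-- is reduced mod m.  In every use below the value is already < m, so
-- this is just the value itself viewed as an element of Fin m.

toPos : (m : ℕ) → Fin m → ℕ → Fin m
toPos (suc k) _ v = v mod (suc k)

outFaro : (N : ℕ) → Fin (2 * N) → Fin (2 * N)
outFaro N p =
  toPos (2 * N) p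
    (if toℕ p <ᵇ N then 2 * toℕ p else 2 * (toℕ p ∸ N) + 1)

inFaro : (N : ℕ) → Fin (2 * N) → Fin (2 * N)
inFaro N p =
  toPos (2 * N) p
    (if toℕ p <ᵇ N then 2 * toℕ p + 1 else 2 * (toℕ p ∸ N))

-- A signed permutation of the 2n
-- positions is represented as a permutation of (position , flipped?)
-- pairs: the card at position i with orientation o is sent to position
-- i' with orientation o or (not o).
-- out: new 2j ← old j (unchanged); new 2j+1 ← old 2n-1-j (turned over)
--   i.e. old i < n ↦ 2i (same), old i ≥ n ↦ 2(2n-1-i)+1 (turned over)
-- in : new 2j ← old 2n-1-j (turned over); new 2j+1 ← old j (unchanged)
--   i.e. old i < n ↦ 2i+1 (same), old i ≥ n ↦ 2(2n-1-i) (turned over)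

Card : ℕ → Set
Card n = Fin (2 * n) × Bool

outFlip : (n : ℕ) → Card n → Card n
outFlip n (p , o) =
  if toℕ p <ᵇ n
  then (toPos (2 * n) p (2 * toℕ p) , o)
  else (toPos (2 * n) p (2 * ((2 * n ∸ 1) ∸ toℕ p) + 1) , not o)

inFlip : (n : ℕ) → Card n → Card n
inFlip n (p , o) =
  if toℕ p <ᵇ n
  then (toPos (2 * n) p (2 * toℕ p + 1) , o)
  else (toPos (2 * n) p (2 * ((2 * n ∸ 1) ∸ toℕ p)) , not o)

data Gen {A : Set} (gs : List (A → A)) : (A → A) → Set where
  gen  : ∀ {g} → g ∈ gs → Gen gs g
  idG  : Gen gs id
  comp : ∀ {f g} → Gen gs f → Gen gs g → Gen gs (f ∘ g)
  inv  : ∀ {f g} → Gen gs f → (∀ x → g (f x) ≡ x) → (∀ x → f (g x) ≡ x) → Gen gs g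
  ext  : ∀ {f g} → Gen gs f → (∀ x → f x ≡ g x) → Gen gs g

Elt : {A : Set} → List (A → A) → Set
Elt {A} gs = Σ (A → A) (Gen gs)

_≈_ : {A : Set} {gs : List (A → A)} → Elt gs → Elt gs → Set
_≈_ {A} (f , _) (g , _) = ∀ (x : A) → f x ≡ g x

_·_ : {A : Set} {gs : List (A → A)} → Elt gs → Elt gs → Elt gs
(f , p) · (g , q) = (f ∘ g , comp p q)

record GroupIso {A B : Set} (gs : List (A → A)) (hs : List (B → B)) : Set where
  field
    φ          : Elt gs → Elt hs
    φ-cong     : ∀ x y → x ≈ y → φ x ≈ φ y
    φ-injective : ∀ x y → φ x ≈ φ y → x ≈ y
    φ-surjective : ∀ (z : Elt hs) → Σ (Elt gs) (λ x → φ x ≈ z)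
    φ-hom      : ∀ x y → φ (x · y) ≈ (φ x · φ y)

FlipGens : (n : ℕ) → List (Card n → Card n)
FlipGens n = outFlip n ∷ inFlip n ∷ []

FaroGens : (N : ℕ) → List (Fin (2 * N) → Fin (2 * N))
FaroGens N = outFaro N ∷ inFaro N ∷ []

module Submission where

-- Idea: a deck of 2n signed cards is the same thing as a mirror-symmetric
-- deck of 4n cards.  Place the deck on top, and below it a reversed copy in
-- which every card is turned over; a card at position q is then recorded at
-- position q of the long deck if it is face-up and at the mirror position
-- 4n-1-q if it is turned over.  This bijection (mirrorDeck) carries the out
-- and in flip shuffles of 2n cards to the out and in faro shuffles of 4n
-- cards, so conjugation by it identifies the two generated groups.

open import Defs
open import Data.Nat using (ℕ; suc; _+_; _*_; _∸_; _<_; _≤_; _<ᵇ_; s≤s; _<?_)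
open import Data.Nat.Properties
open import Data.Nat.DivMod using (m<n⇒m%n≡m)
open import Data.Nat.Tactic.RingSolver using (solve-∀)
open import Data.Fin using (Fin; toℕ; opposite; cast; join; splitAt; _↑ʳ_)
open import Data.Fin.Properties
  using (toℕ-fromℕ<; toℕ-injective; toℕ<n; opposite-prop; opposite-involutive;
         toℕ-cast; cast-involutive; toℕ-↑ˡ; toℕ-↑ʳ; join-splitAt; splitAt-join)
open import Data.Bool using (Bool; true; false; if_then_else_; not)
open import Data.Product using (_×_; _,_; ∃-syntax)
open import Data.Sum using (_⊎_; inj₁; inj₂)
open import Data.List using (List)
open import Data.List.Relation.Unary.Any using (here; there)
open import Data.List.Membership.Propositional using (_∈_)
open import Data.List.Relation.Binary.Pointwise using (Pointwise; []; _∷_)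
open import Data.List.Relation.Binary.Pointwise.Properties using (symmetric)
open import Function using (_∘_)
open import Function.Bundles using (Inverse; _↔_; mk↔ₛ′)
open import Function.Properties.Inverse using (↔-sym)
open import Relation.Nullary using (yes; no; contradiction)
open import Relation.Binary.PropositionalEquality
open ≡-Reasoning

-- 1. Conjugate generating sets generate isomorphic groups.

Intertwines : {A B : Set} → A ↔ B → (A → A) → (B → B) → Set
Intertwines {A} ψ g h = ∀ (x : A) → Inverse.to ψ (g x) ≡ h (Inverse.to ψ x)

intertwines-sym : {A B : Set} (ψ : A ↔ B) {g : A → A} {h : B → B} →
                  Intertwines ψ g h → Intertwines (↔-sym ψ) h g
intertwines-sym ψ {g} {h} ψg≡hψ y = begin
  from (h y)                ≡⟨ cong (from ∘ h) (strictlyInverseˡ y) ⟨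
  from (h (to (from y)))    ≡⟨ cong from (ψg≡hψ (from y)) ⟨
  from (to (g (from y)))    ≡⟨ strictlyInverseʳ (g (from y)) ⟩
  g (from y)                ∎
  where open Inverse ψ

module Conjugation {A B : Set} (ψ : A ↔ B) where
  open Inverse ψ

  conjugate : (A → A) → (B → B)
  conjugate f = to ∘ f ∘ from

  conjugate-generator : {hs : List (B → B)} {g : A → A} {h : B → B} →
                        h ∈ hs → Intertwines ψ g h → Gen hs (conjugate g)
  conjugate-generator {g = g} {h} h∈hs ψg≡hψ =
    ext (gen h∈hs) (λ y → sym (trans (ψg≡hψ (from y)) (cong h (strictlyInverseˡ y))))

  conjugate-Gen : {gs : List (A → A)} {hs : List (B → B)} →
                  (∀ {g} → g ∈ gs → Gen hs (conjugate g)) →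
                  ∀ {f} → Gen gs f → Gen hs (conjugate f)
  conjugate-Gen on-gens (gen g∈gs) = on-gens g∈gs
  conjugate-Gen on-gens idG = ext idG (λ y → sym (strictlyInverseˡ y))
  conjugate-Gen on-gens (comp {f} {g} p q) =
    ext (comp (conjugate-Gen on-gens p) (conjugate-Gen on-gens q))
        (λ y → cong (to ∘ f) (strictlyInverseʳ (g (from y))))
  conjugate-Gen on-gens (inv {f} {g} p gf≡id fg≡id) =
    inv (conjugate-Gen on-gens p)
        (λ y → trans (cong (to ∘ g) (strictlyInverseʳ (f (from y))))
                     (trans (cong to (gf≡id (from y))) (strictlyInverseˡ y)))
        (λ y → trans (cong (to ∘ f) (strictlyInverseʳ (g (from y))))
                     (trans (cong to (fg≡id (from y))) (strictlyInverseˡ y)))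
  conjugate-Gen on-gens (ext p f≗g) = ext (conjugate-Gen on-gens p) (λ y → cong to (f≗g (from y)))

partner : {A B : Set} {R : A → B → Set} {gs : List A} {hs : List B} →
          Pointwise R gs hs → ∀ {g} → g ∈ gs → ∃[ h ] (h ∈ hs × R g h)
partner (r ∷ _)  (here refl) = _ , here refl , r
partner (_ ∷ rs) (there g∈gs) with partner rs g∈gs
... | h , h∈hs , r = h , there h∈hs , r

conjugate-Gen-intertwined : {A B : Set} (ψ : A ↔ B) {gs : List (A → A)} {hs : List (B → B)} →
  Pointwise (Intertwines ψ) gs hs → ∀ {f} → Gen gs f → Gen hs (Conjugation.conjugate ψ f)
conjugate-Gen-intertwined ψ gs∼hs = conjugate-Gen on-gens
  where
  open Conjugation ψ
  on-gens : ∀ {g} → g ∈ _ → Gen _ (conjugate g)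
  on-gens g∈gs with partner gs∼hs g∈gs
  ... | h , h∈hs , ψg≡hψ = conjugate-generator h∈hs ψg≡hψ

intertwiningIso : {A B : Set} (ψ : A ↔ B) {gs : List (A → A)} {hs : List (B → B)} →
                  Pointwise (Intertwines ψ) gs hs → GroupIso gs hs
intertwiningIso ψ gs∼hs = record
  { φ            = λ { (f , p) → to ∘ f ∘ from , conjugate-Gen-intertwined ψ gs∼hs p }
  ; φ-cong       = λ { (f , _) (g , _) f≗g y → cong to (f≗g (from y)) }
  ; φ-injective  = λ { (f , _) (g , _) ψfψ⁻¹≗ψgψ⁻¹ x → begin
        f x                          ≡⟨ cong f (strictlyInverseʳ x) ⟨
        f (from (to x))              ≡⟨ strictlyInverseʳ _ ⟨
        from (to (f (from (to x))))  ≡⟨ cong from (ψfψ⁻¹≗ψgψ⁻¹ (to x)) ⟩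
        from (to (g (from (to x))))  ≡⟨ strictlyInverseʳ _ ⟩
        g (from (to x))              ≡⟨ cong g (strictlyInverseʳ x) ⟩
        g x                          ∎ }
  ; φ-surjective = λ { (h , q) →
        (from ∘ h ∘ to , conjugate-Gen-intertwined (↔-sym ψ)
                           (symmetric (intertwines-sym ψ) gs∼hs) q)
        , λ y → trans (strictlyInverseˡ _) (cong h (strictlyInverseˡ y)) }
  ; φ-hom        = λ { (f , _) (g , _) y → cong (to ∘ f) (sym (strictlyInverseʳ _)) }
  }
  where open Inverse ψ

-- 2. Arithmetic of positions.  A deck of 2N cards has its top half at
-- [0, N) and its bottom half at N + [0, N); mirroring a deck of M cards sends
-- position x to M ∸ suc x (the value of Data.Fin.opposite).

-- 2 * N unfolds to N + (N + 0); this states it as N + N.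
two* : ∀ N → 2 * N ≡ N + N
two* N = cong (N +_) (+-identityʳ N)

∸-by : ∀ {a} b {c} → a ≡ b + c → a ∸ b ≡ c
∸-by b {c} refl = m+n∸m≡n b c

mirror-< : ∀ {N x} → x < N → N ∸ suc x < N
mirror-< {suc N} {x} _ = s≤s (m∸n≤m N x)

mirror-involutive : ∀ {N x} → x < N → N ∸ suc (N ∸ suc x) ≡ x
mirror-involutive {N} {x} x<N = begin
  N ∸ suc (N ∸ suc x)  ≡⟨ cong (N ∸_) (+-∸-assoc 1 x<N) ⟨
  N ∸ (N ∸ x)          ≡⟨ m∸[m∸n]≡n (<⇒≤ x<N) ⟩
  x                    ∎

mirror-top : ∀ {N x} → x < N → 2 * N ∸ suc x ≡ N + (N ∸ suc x)
mirror-top {N} {x} x<N = trans (cong (_∸ suc x) (two* N)) (+-∸-assoc N x<N)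

mirror-bottom : ∀ N x → 2 * N ∸ suc (N + x) ≡ N ∸ suc x
mirror-bottom N x = begin
  2 * N ∸ suc (N + x)    ≡⟨ cong₂ _∸_ (two* N) (sym (+-suc N x)) ⟩
  (N + N) ∸ (N + suc x)  ≡⟨ [m+n]∸[m+o]≡n∸o N N (suc x) ⟩
  N ∸ suc x              ∎

mirror-even : ∀ {N x} → x < N → 2 * N ∸ suc (2 * x) ≡ 2 * (N ∸ suc x) + 1
mirror-even {N} {x} x<N with m≤n⇒∃[o]m+o≡n x<N
... | k , refl = trans (∸-by (suc (2 * x)) (ring x k)) (cong (λ y → 2 * y + 1) (sym (m+n∸m≡n (suc x) k)))
  where ring : ∀ x k → 2 * (suc x + k) ≡ suc (2 * x) + (2 * k + 1)
        ring = solve-∀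

mirror-odd : ∀ {N x} → x < N → 2 * N ∸ suc (2 * x + 1) ≡ 2 * (N ∸ suc x)
mirror-odd {N} {x} x<N with m≤n⇒∃[o]m+o≡n x<N
... | k , refl = trans (∸-by (suc (2 * x + 1)) (ring x k)) (cong (2 *_) (sym (m+n∸m≡n (suc x) k)))
  where ring : ∀ x k → 2 * (suc x + k) ≡ suc (2 * x + 1) + 2 * k
        ring = solve-∀

double-< : ∀ {N x} → x < N → 2 * x < 2 * N
double-< = *-monoʳ-< 2

double+1-< : ∀ {N x} → x < N → 2 * x + 1 < 2 * N
double+1-< {N} {x} x<N = subst (_≤ 2 * N) (ring x) (*-monoʳ-≤ 2 x<N)
  where ring : ∀ x → 2 * suc x ≡ suc (2 * x + 1)
        ring = solve-∀

data Half (N x : ℕ) : Set where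
  top    : x < N → Half N x
  bottom : (i : ℕ) → i < N → x ≡ N + i → Half N x

half : ∀ N x → x < 2 * N → Half N x
half N x x<2N with x <? N
... | yes x<N = top x<N
... | no x≮N with m≤n⇒∃[o]m+o≡n (≮⇒≥ x≮N)
...   | i , refl = bottom i (+-cancelˡ-< N i N (subst (N + i <_) (two* N) x<2N)) refl

if-top : ∀ {A : Set} {x N} {a b : A} → x < N → (if x <ᵇ N then a else b) ≡ a
if-top {x = x} {N} x<N with x <ᵇ N | <⇒<ᵇ x<N
... | true | _ = refl

if-bottom : ∀ {A : Set} {x N} {a b : A} → N ≤ x → (if x <ᵇ N then a else b) ≡ b
if-bottom {x = x} {N} N≤x with x <ᵇ N | <ᵇ⇒< x N
... | false | _ = refl
... | true | x<N = contradiction (x<N _) (≤⇒≯ N≤x)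

toℕ-toPos : ∀ {m} (p : Fin m) {v} → v < m → toℕ (toPos m p v) ≡ v
toℕ-toPos {suc k} p v<m = trans (toℕ-fromℕ< _) (m<n⇒m%n≡m v<m)

-- 3. Riffles and mirror pairs.

-- The out faro shuffle is riffle N (2 *_) (2 *_ + 1)
-- and the in faro shuffle is riffle N (2 *_ + 1) (2 *_).
riffle : (N : ℕ) (f g : ℕ → ℕ) → Fin (2 * N) → Fin (2 * N)
riffle N f g p = toPos (2 * N) p (if toℕ p <ᵇ N then f (toℕ p) else g (toℕ p ∸ N))

record MirrorPair (N : ℕ) (f g : ℕ → ℕ) : Set where
  field
    f-<      : ∀ {x} → x < N → f x < 2 * N
    g-<      : ∀ {x} → x < N → g x < 2 * N
    mirror-f : ∀ {x} → x < N → 2 * N ∸ suc (f x) ≡ g (N ∸ suc x)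
    mirror-g : ∀ {x} → x < N → 2 * N ∸ suc (g x) ≡ f (N ∸ suc x)

swapPair : ∀ {N f g} → MirrorPair N f g → MirrorPair N g f
swapPair P = record { f-< = g-< ; g-< = f-< ; mirror-f = mirror-g ; mirror-g = mirror-f }
  where open MirrorPair P

outPair : ∀ N → MirrorPair N (2 *_) (λ i → 2 * i + 1)
outPair N = record
  { f-< = double-< ; g-< = double+1-< ; mirror-f = mirror-even ; mirror-g = mirror-odd }

inPair : ∀ N → MirrorPair N (λ i → 2 * i + 1) (2 *_)
inPair N = swapPair (outPair N)

module RiffleProperties {N f g} (P : MirrorPair N f g) where
  open MirrorPair P

  riffle-top : (p : Fin (2 * N)) {x : ℕ} → toℕ p ≡ x → x < N → toℕ (riffle N f g p) ≡ f x
  riffle-top p refl x<N = trans (cong (toℕ ∘ toPos (2 * N) p) (if-top x<N)) (toℕ-toPos p (f-< x<N))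

  riffle-bottom : (p : Fin (2 * N)) {i : ℕ} → toℕ p ≡ N + i → i < N → toℕ (riffle N f g p) ≡ g i
  riffle-bottom p {i} p≡N+i i<N =
    trans (cong (toℕ ∘ toPos (2 * N) p)
                (trans (if-bottom (subst (N ≤_) (sym p≡N+i) (m≤m+n N i))) (cong g (∸-by N p≡N+i))))
          (toℕ-toPos p (g-< i<N))

  riffle-opposite : ∀ p → riffle N f g (opposite p) ≡ opposite (riffle N f g p)
  riffle-opposite p = toℕ-injective (by-half (half N (toℕ p) (toℕ<n p)))
    where
    by-half : Half N (toℕ p) → toℕ (riffle N f g (opposite p)) ≡ toℕ (opposite (riffle N f g p))
    by-half (top x<N) = begin
      toℕ (riffle N f g (opposite p))         ≡⟨ riffle-bottom (opposite p)
                                                   (trans (opposite-prop p) (mirror-top x<N)) (mirror-< x<N) ⟩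
      g (N ∸ suc (toℕ p))                     ≡⟨ mirror-f x<N ⟨
      2 * N ∸ suc (f (toℕ p))                 ≡⟨ cong (λ y → 2 * N ∸ suc y) (riffle-top p refl x<N) ⟨
      2 * N ∸ suc (toℕ (riffle N f g p))      ≡⟨ opposite-prop _ ⟨
      toℕ (opposite (riffle N f g p))         ∎
    by-half (bottom i i<N p≡N+i) = begin
      toℕ (riffle N f g (opposite p))         ≡⟨ riffle-top (opposite p) opposite-p (mirror-< i<N) ⟩
      f (N ∸ suc i)                           ≡⟨ mirror-g i<N ⟨
      2 * N ∸ suc (g i)                       ≡⟨ cong (λ y → 2 * N ∸ suc y) (riffle-bottom p p≡N+i i<N) ⟨
      2 * N ∸ suc (toℕ (riffle N f g p))      ≡⟨ opposite-prop _ ⟨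
      toℕ (opposite (riffle N f g p))         ∎
      where
      opposite-p : toℕ (opposite p) ≡ N ∸ suc i
      opposite-p = trans (opposite-prop p)
                         (trans (cong (λ y → 2 * N ∸ suc y) p≡N+i) (mirror-bottom N i))

-- 4. Signed riffles and the mirror deck.

turn : {A : Set} → A × Bool → A × Bool
turn (p , o) = p , not o

-- The flip-shuffle analogue of riffle: top-half cards go to f x face
-- unchanged, the bottom half is reversed (j = 2n-1-x) and turned over and
-- goes to g j.  outFlip n = signedRiffle n (2 *_) (2 *_ + 1) and
-- inFlip n = signedRiffle n (2 *_ + 1) (2 *_).
signedRiffle : (n : ℕ) (f g : ℕ → ℕ) → Card n → Card n
signedRiffle n f g (p , o) =
  if toℕ p <ᵇ n
  then (toPos (2 * n) p (f (toℕ p)) , o)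
  else (toPos (2 * n) p (g ((2 * n ∸ 1) ∸ toℕ p)) , not o)

signedRiffle-turn : ∀ n f g c → signedRiffle n f g (turn c) ≡ turn (signedRiffle n f g c)
signedRiffle-turn n f g (p , o) with toℕ p <ᵇ n
... | true  = refl
... | false = refl

-- Face-up cards go to the top half, turned-over cards to the reversed
-- bottom half; fromMirror is the inverse assignment.
toMirror : ∀ {m} → Fin m × Bool → Fin m ⊎ Fin m
toMirror (q , false) = inj₁ q
toMirror (q , true)  = inj₂ (opposite q)

fromMirror : ∀ {m} → Fin m ⊎ Fin m → Fin m × Bool
fromMirror (inj₁ q) = q , false
fromMirror (inj₂ q) = opposite q , true

mirrorDeck : (m : ℕ) → (Fin m × Bool) ↔ Fin (2 * m)
mirrorDeck m = mk↔ₛ′ to from to∘from from∘to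
  where
  widen : Fin (m + m) → Fin (2 * m)
  widen = cast (sym (two* m))

  narrow : Fin (2 * m) → Fin (m + m)
  narrow = cast (two* m)

  to : Fin m × Bool → Fin (2 * m)
  to = widen ∘ join m m ∘ toMirror

  from : Fin (2 * m) → Fin m × Bool
  from = fromMirror ∘ splitAt m ∘ narrow

  toMirror∘fromMirror : ∀ s → toMirror (fromMirror s) ≡ s
  toMirror∘fromMirror (inj₁ q) = refl
  toMirror∘fromMirror (inj₂ q) = cong inj₂ (opposite-involutive q)

  fromMirror∘toMirror : ∀ c → fromMirror (toMirror c) ≡ c
  fromMirror∘toMirror (q , false) = refl
  fromMirror∘toMirror (q , true)  = cong (_, true) (opposite-involutive q)

  to∘from : ∀ y → to (from y) ≡ y
  to∘from y = begin
    widen (join m m (toMirror (fromMirror (splitAt m (narrow y)))))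
      ≡⟨ cong (widen ∘ join m m) (toMirror∘fromMirror (splitAt m (narrow y))) ⟩
    widen (join m m (splitAt m (narrow y)))  ≡⟨ cong widen (join-splitAt m m (narrow y)) ⟩
    widen (narrow y)                         ≡⟨ cast-involutive (sym (two* m)) (two* m) y ⟩
    y                                        ∎

  from∘to : ∀ c → from (to c) ≡ c
  from∘to c = begin
    fromMirror (splitAt m (narrow (widen (join m m (toMirror c)))))
      ≡⟨ cong (fromMirror ∘ splitAt m) (cast-involutive (two* m) (sym (two* m)) (join m m (toMirror c))) ⟩
    fromMirror (splitAt m (join m m (toMirror c)))  ≡⟨ cong fromMirror (splitAt-join m m (toMirror c)) ⟩
    fromMirror (toMirror c)                         ≡⟨ fromMirror∘toMirror c ⟩
    c                                               ∎

module MirrorDeck {m : ℕ} where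
  open Inverse (mirrorDeck m) using (to)

  toℕ-faceUp : ∀ q → toℕ (to (q , false)) ≡ toℕ q
  toℕ-faceUp q = trans (toℕ-cast _ _) (toℕ-↑ˡ q m)

  to-turn : ∀ c → to (turn c) ≡ opposite (to c)
  to-turn (q , false) = toℕ-injective (begin
    toℕ (to (q , true))                ≡⟨ toℕ-cast _ _ ⟩
    toℕ (m ↑ʳ opposite q)              ≡⟨ toℕ-↑ʳ m (opposite q) ⟩
    m + toℕ (opposite q)               ≡⟨ cong (m +_) (opposite-prop q) ⟩
    m + (m ∸ suc (toℕ q))              ≡⟨ mirror-top (toℕ<n q) ⟨
    2 * m ∸ suc (toℕ q)                ≡⟨ cong (λ y → 2 * m ∸ suc y) (toℕ-faceUp q) ⟨
    2 * m ∸ suc (toℕ (to (q , false))) ≡⟨ opposite-prop _ ⟨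
    toℕ (opposite (to (q , false)))    ∎)
  to-turn (q , true) = begin
    to (q , false)                     ≡⟨ opposite-involutive _ ⟨
    opposite (opposite (to (q , false))) ≡⟨ cong opposite (to-turn (q , false)) ⟨
    opposite (to (q , true))           ∎

  toℕ-turnedOver : ∀ q → toℕ (to (q , true)) ≡ 2 * m ∸ suc (toℕ q)
  toℕ-turnedOver q = begin
    toℕ (to (q , true))                ≡⟨ cong toℕ (to-turn (q , false)) ⟩
    toℕ (opposite (to (q , false)))    ≡⟨ opposite-prop _ ⟩
    2 * m ∸ suc (toℕ (to (q , false))) ≡⟨ cong (λ y → 2 * m ∸ suc y) (toℕ-faceUp q) ⟩
    2 * m ∸ suc (toℕ q)                ∎

module SignedRiffle {n f g} (Pₙ : MirrorPair n f g) (P₂ₙ : MirrorPair (2 * n) f g) where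
  open Inverse (mirrorDeck (2 * n)) using (to)
  open MirrorDeck {2 * n}
  open RiffleProperties P₂ₙ using (riffle-top; riffle-opposite)
  open MirrorPair

  faceUp-top : (p : Fin (2 * n)) → toℕ p < n →
    toℕ (to (signedRiffle n f g (p , false))) ≡ toℕ (riffle (2 * n) f g (to (p , false)))
  faceUp-top p x<n = begin
    toℕ (to (signedRiffle n f g (p , false)))  ≡⟨ cong (toℕ ∘ to) (if-top x<n) ⟩
    toℕ (to (toPos (2 * n) p (f (toℕ p)) , false)) ≡⟨ toℕ-faceUp _ ⟩
    toℕ (toPos (2 * n) p (f (toℕ p)))           ≡⟨ toℕ-toPos p (f-< Pₙ x<n) ⟩
    f (toℕ p)                                   ≡⟨ riffle-top (to (p , false)) (toℕ-faceUp p) (toℕ<n p) ⟨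
    toℕ (riffle (2 * n) f g (to (p , false)))   ∎

  -- A face-up card at n + i is reversed to j = n-1-i, turned over and sent
  -- to g j; in the mirror deck that is position 4n-1-g j = f (n + i).
  faceUp-bottom : (p : Fin (2 * n)) (i : ℕ) → i < n → toℕ p ≡ n + i →
    toℕ (to (signedRiffle n f g (p , false))) ≡ toℕ (riffle (2 * n) f g (to (p , false)))
  faceUp-bottom p i i<n p≡n+i = begin
    toℕ (to (signedRiffle n f g (p , false)))  ≡⟨ cong (toℕ ∘ to) (if-bottom n≤p) ⟩
    toℕ (to (toPos (2 * n) p (g j′) , true))    ≡⟨ cong (λ y → toℕ (to (toPos (2 * n) p (g y) , true))) j′≡j ⟩
    toℕ (to (toPos (2 * n) p (g j) , true))     ≡⟨ toℕ-turnedOver _ ⟩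
    2 * (2 * n) ∸ suc (toℕ (toPos (2 * n) p (g j)))
      ≡⟨ cong (λ y → 2 * (2 * n) ∸ suc y) (toℕ-toPos p (g-< Pₙ j<n)) ⟩
    2 * (2 * n) ∸ suc (g j)                     ≡⟨ mirror-g P₂ₙ j<2n ⟩
    f (2 * n ∸ suc j)                           ≡⟨ cong f (mirror-top j<n) ⟩
    f (n + (n ∸ suc j))                         ≡⟨ cong (λ y → f (n + y)) (mirror-involutive i<n) ⟩
    f (n + i)                                   ≡⟨ riffle-top (to (p , false)) (trans (toℕ-faceUp p) p≡n+i)
                                                     (subst (_< 2 * n) p≡n+i (toℕ<n p)) ⟨
    toℕ (riffle (2 * n) f g (to (p , false)))   ∎
    where
    j′ j : ℕ
    j′ = (2 * n ∸ 1) ∸ toℕ p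
    j  = n ∸ suc i
    n≤p : n ≤ toℕ p
    n≤p = subst (n ≤_) (sym p≡n+i) (m≤m+n n i)
    j′≡j : j′ ≡ j
    j′≡j = begin
      (2 * n ∸ 1) ∸ toℕ p  ≡⟨ ∸-+-assoc (2 * n) 1 (toℕ p) ⟩
      2 * n ∸ suc (toℕ p)  ≡⟨ cong (λ y → 2 * n ∸ suc y) p≡n+i ⟩
      2 * n ∸ suc (n + i)  ≡⟨ mirror-bottom n i ⟩
      n ∸ suc i            ∎
    j<n : j < n
    j<n = mirror-< i<n
    j<2n : j < 2 * n
    j<2n = <-≤-trans j<n (m≤m+n n (n + 0))

  faceUp : ∀ p → to (signedRiffle n f g (p , false)) ≡ riffle (2 * n) f g (to (p , false))
  faceUp p with half n (toℕ p) (toℕ<n p)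
  ... | top x<n            = toℕ-injective (faceUp-top p x<n)
  ... | bottom i i<n p≡n+i = toℕ-injective (faceUp-bottom p i i<n p≡n+i)

  -- Turned-over cards reduce to face-up ones: turning commutes with the
  -- signed riffle on one side and with mirroring the deck on the other.
  intertwines : Intertwines (mirrorDeck (2 * n)) (signedRiffle n f g) (riffle (2 * n) f g)
  intertwines (p , false) = faceUp p
  intertwines (p , true)  = begin
    to (signedRiffle n f g (turn (p , false)))   ≡⟨ cong to (signedRiffle-turn n f g (p , false)) ⟩
    to (turn (signedRiffle n f g (p , false)))   ≡⟨ to-turn (signedRiffle n f g (p , false)) ⟩
    opposite (to (signedRiffle n f g (p , false))) ≡⟨ cong opposite (faceUp p) ⟩
    opposite (riffle (2 * n) f g (to (p , false))) ≡⟨ riffle-opposite (to (p , false)) ⟨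
    riffle (2 * n) f g (opposite (to (p , false))) ≡⟨ cong (riffle (2 * n) f g) (to-turn (p , false)) ⟨
    riffle (2 * n) f g (to (p , true))           ∎

-- 5. The theorem.  outFlip n and inFlip n are the signed riffles of the out
-- and in mirror pairs, outFaro (2 * n) and inFaro (2 * n) the corresponding
-- riffles (both definitionally), so the mirror deck intertwines the
-- generators one by one.
theorem2 : (n : ℕ) → 1 ≤ n → GroupIso (FlipGens n) (FaroGens (2 * n))
theorem2 n _ = intertwiningIso (mirrorDeck (2 * n)) (outFlip∼outFaro ∷ inFlip∼inFaro ∷ [])
  where
  outFlip∼outFaro : Intertwines (mirrorDeck (2 * n)) (outFlip n) (outFaro (2 * n))
  outFlip∼outFaro = SignedRiffle.intertwines (outPair n) (outPair (2 * n))

  inFlip∼inFaro : Intertwines (mirrorDeck (2 * n)) (inFlip n) (inFaro (2 * n))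
  inFlip∼inFaro = SignedRiffle.intertwines (inPair n) (inPair (2 * n))
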